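{- Let $d\geq 2$ and let $[B_1,\dots,B_k]$ be an ordered partition of $[d+1]$. Then the faces of the permutahedron $\mathrm{Perm}_d$ satisfy \[ [B_2,\dots,B_k,B_1]=[B_1,B_2,\dots,B_k]+\sum_{b\in B_1}w_b. \]
   Context: $\mathrm{Perm}_d=\operatorname{conv}\{(\sigma(1),\dots,\sigma(d+1)):\sigma\in\mathfrak S_{d+1}\}\subset\mathbb{R}^{d+1}$, and $w_i=(d+1)e_i-\sum_{j=1}^{d+1}e_j$. An ordered partition $[B_1,\dots,B_k]$ of $[d+1]$ is a tuple of nonempty disjoint sets (blocks) with union $[d+1]$. It labels the face of $\mathrm{Perm}_d$ given as the convex hull of all permutation vectors $(x_1,\dots,x_{d+1})$ of $[d+1]$ with $\{x_a: a\in B_i\}=\{b_{i-1}+1,\dots,b_i\}$ for all $i$, where $b_i=|B_1|+\dots+|B_i|$ and $b_0=0$; for a vector $v$, $[B_1,\dots,B_k]+v$ denotes the translate of this face by $v$.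
   Formalization: The faces of $\mathrm{Perm}_d$ and their translates are taken in ℚ^(d+1) rather than $\mathbb{R}^{d+1}$, as sets of rational points formed with rational convex weights. -}

module Defs where

open import Data.Nat as ℕ using (ℕ; zero; suc)
open import Data.Fin as Fin using (Fin; zero; suc; toℕ; fromℕ; inject₁)
open import Data.Fin.Permutation using (Permutation′; _⟨$⟩ʳ_)
open import Data.Rational as ℚ using (ℚ; 0ℚ; 1ℚ; _+_; _*_; _-_; _≤_; _/_)
open import Data.List using (List; map; foldr)
open import Data.List.Relation.Unary.All using (All)
open import Data.Product using (Σ; ∃; ∃-syntax; _×_; _,_; proj₁)
open import Data.Bool using (Bool; if_then_else_)
open import Relation.Binary.PropositionalEquality using (_≡_)
open import Relation.Nullary.Decidable using (⌊_⌋)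
open import Function.Bundles using (_⇔_)

-- points of ℚ^n (coordinates indexed by Fin n; index i ↔ coordinate i+1)
Point : ℕ → Set
Point n = Fin n → ℚ

∑ℕ : (n : ℕ) → (Fin n → ℕ) → ℕ
∑ℕ zero    f = 0
∑ℕ (suc n) f = f zero ℕ.+ ∑ℕ n (λ i → f (suc i))

∑ℚ : (n : ℕ) → (Fin n → ℚ) → ℚ
∑ℚ zero    f = 0ℚ
∑ℚ (suc n) f = f zero + ∑ℚ n (λ i → f (suc i))

sumℚ : List ℚ → ℚ
sumℚ = foldr _+_ 0ℚ

count : (n : ℕ) → (Fin n → Bool) → ℕ
count n P = ∑ℕ n (λ a → if P a then 1 else 0)

-- An ordered partition [B_1,…,B_k] of [n] with k blocks is encoded by its
-- block-assignment f : Fin n → Fin k (B_{j+1} = f⁻¹(j)); blocks nonempty = f surjective.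
IsOrderedPartition : {n k : ℕ} → (Fin n → Fin k) → Set
IsOrderedPartition {n} {k} f = (j : Fin k) → ∃[ a ] f a ≡ j

blockSize : {n k : ℕ} → (Fin n → Fin k) → Fin k → ℕ
blockSize {n} f j = count n (λ a → ⌊ f a Fin.≟ j ⌋)

-- b_j = |B_1| + … + |B_j|  (sizes of the blocks strictly before block j, 0-indexed)
before : {n k : ℕ} → (Fin n → Fin k) → Fin k → ℕ
before {n} f j = count n (λ a → ⌊ f a Fin.<? j ⌋)

permVec : {n : ℕ} → Permutation′ n → Fin n → ℕ
permVec σ a = suc (toℕ (σ ⟨$⟩ʳ a))

-- the permutation vector of σ lies in the face labelled by f:
-- {x_a : a ∈ B_{j+1}} = {b_j + 1, …, b_{j+1}} for every block j
InFace : {n k : ℕ} → (Fin n → Fin k) → Permutation′ n → Set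
InFace {n} {k} f σ = (j : Fin k) (v : ℕ) →
  (∃[ a ] (f a ≡ j × permVec σ a ≡ v))
    ⇔ ((before f j ℕ.< v) × (v ℕ.≤ before f j ℕ.+ blockSize f j))

ℕ→ℚ : ℕ → ℚ
ℕ→ℚ m = (Data.Integer.+ m) ℚ./ 1 where import Data.Integer

Conv : {n : ℕ} → (Permutation′ n → Set) → Point n → Set
Conv {n} V p = ∃[ L ] (All (λ (lσ : ℚ × Permutation′ n) → (0ℚ ≤ proj₁ lσ) × V (Data.Product.proj₂ lσ)) L
                   × sumℚ (map proj₁ L) ≡ 1ℚ
                   × ((i : Fin n) → p i ≡ sumℚ (map (λ (lσ : ℚ × Permutation′ n) →
                          proj₁ lσ * ℕ→ℚ (permVec (Data.Product.proj₂ lσ) i)) L)))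

Face : {n k : ℕ} → (Fin n → Fin k) → Point n → Set
Face f = Conv (InFace f)

_⊕_ : {n : ℕ} → (Point n → Set) → Point n → (Point n → Set)
(F ⊕ v) p = ∃[ q ] (F q × ((i : Fin _) → p i ≡ q i + v i))

_≐_ : {n : ℕ} → (Point n → Set) → (Point n → Set) → Set
F ≐ G = ∀ p → F p ⇔ G p

w : (d : ℕ) → Fin (suc d) → Point (suc d)
w d b i = (if ⌊ i Fin.≟ b ⌋ then ℕ→ℚ (suc d) else 0ℚ) - 1ℚ

wSum : (d : ℕ) {m : ℕ} → (Fin (suc d) → Fin (suc m)) → Point (suc d)
wSum d f i = ∑ℚ (suc d) (λ b → if ⌊ f b Fin.≟ zero ⌋ then w d b i else 0ℚ)

-- cyclic relabelling: block 0 (B_1) goes last, block j+1 goes to position j,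
-- so rotate ∘ f encodes [B_2,…,B_k,B_1]
rotate : {m : ℕ} → Fin (suc m) → Fin (suc m)
rotate {m} zero    = fromℕ m
rotate     (suc j) = inject₁ j

-- A vertex of the face [B₁,…,B_k] gives B₁ the values 1,…,s (s = |B₁|) and the other blocks,
-- in order, the values s+1,…,n. Rotating the values cyclically by r = n − s (t ↦ t + r on the
-- values of B₁, t ↦ t − s on the others) maps these vertices bijectively onto the vertices of
-- [B₂,…,B_k,B₁]. Coordinatewise it adds n − s on B₁ and −s elsewhere, which is ∑_{b∈B₁} w_b;
-- as every vertex moves by the same vector, so does their convex hull.

module Submission where

open import Defs
open import Data.Nat using (ℕ; suc; _≤_)
open import Data.Fin using (Fin)
open import Function using (_∘_)

module Decisions where
  open import Data.Bool using (if_then_else_)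
  open import Relation.Nullary using (Dec; yes; no; ¬_)
  open import Relation.Nullary.Decidable using (⌊_⌋)
  open import Relation.Nullary.Negation using (contradiction)
  open import Relation.Binary.PropositionalEquality using (_≡_; refl; sym)
  open import Function.Bundles using (_⇔_; module Equivalence)

  module _ {a} {A : Set a} {x y : A} where

    if-yes : ∀ {ℓ} {P : Set ℓ} (p? : Dec P) → P → (if ⌊ p? ⌋ then x else y) ≡ x
    if-yes (yes _) _  = refl
    if-yes (no ¬p) p = contradiction p ¬p

    if-no : ∀ {ℓ} {P : Set ℓ} (p? : Dec P) → ¬ P → (if ⌊ p? ⌋ then x else y) ≡ y
    if-no (yes p) ¬p = contradiction p ¬p
    if-no (no _)  _  = refl

    if-⇔ : ∀ {ℓ₁ ℓ₂} {P : Set ℓ₁} {Q : Set ℓ₂} → P ⇔ Q → (p? : Dec P) (q? : Dec Q) →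
           (if ⌊ p? ⌋ then x else y) ≡ (if ⌊ q? ⌋ then x else y)
    if-⇔ P⇔Q (yes p) q? = sym (if-yes q? (Equivalence.to P⇔Q p))
    if-⇔ P⇔Q (no ¬p) q? = sym (if-no q? (¬p ∘ Equivalence.from P⇔Q))

open Decisions

module NatSums where
  open import Data.Nat
  open import Data.Nat.Properties using (+-commutativeSemigroup; +-mono-≤)
  open import Data.Fin using (Fin; zero; suc)
  open import Relation.Binary.PropositionalEquality using (_≡_; refl; cong; cong₂; trans)
  open import Algebra.Properties.CommutativeSemigroup +-commutativeSemigroup using (interchange)

  ∑ℕ-cong : ∀ n {g h : Fin n → ℕ} → (∀ a → g a ≡ h a) → ∑ℕ n g ≡ ∑ℕ n h
  ∑ℕ-cong zero    g≗h = refl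
  ∑ℕ-cong (suc n) g≗h = cong₂ _+_ (g≗h zero) (∑ℕ-cong n (g≗h ∘ suc))

  ∑ℕ-distrib-+ : ∀ n (g h : Fin n → ℕ) → ∑ℕ n (λ a → g a + h a) ≡ ∑ℕ n g + ∑ℕ n h
  ∑ℕ-distrib-+ zero    g h = refl
  ∑ℕ-distrib-+ (suc n) g h = trans (cong (g zero + h zero +_) (∑ℕ-distrib-+ n (g ∘ suc) (h ∘ suc)))
                                   (interchange (g zero) (h zero) _ _)

  ∑ℕ-mono-≤ : ∀ n {g h : Fin n → ℕ} → (∀ a → g a ≤ h a) → ∑ℕ n g ≤ ∑ℕ n h
  ∑ℕ-mono-≤ zero    g≤h = z≤n
  ∑ℕ-mono-≤ (suc n) g≤h = +-mono-≤ (g≤h zero) (∑ℕ-mono-≤ n (g≤h ∘ suc))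

  ∑ℕ-const : ∀ n c → ∑ℕ n (λ _ → c) ≡ n * c
  ∑ℕ-const zero    c = refl
  ∑ℕ-const (suc n) c = cong (c +_) (∑ℕ-const n c)

module Rationals where
  open import Data.Nat as ℕ using (ℕ; zero; suc)
  open import Data.Integer as ℤ using (1ℤ)
  import Data.Integer.Properties as ℤ
  open import Data.Fin as Fin using (Fin; zero; suc)
  open import Data.Fin.Properties using (suc-injective)
  open import Data.Bool using (if_then_else_)
  open import Relation.Nullary.Decidable using (⌊_⌋)
  open import Function.Bundles using (mk⇔)
  open import Data.Rational using (ℚ; 0ℚ; _+_; _-_; toℚᵘ)
  open import Data.Rational.Properties using (toℚᵘ-injective; toℚᵘ-fromℚᵘ; toℚᵘ-homo-+; +-identityˡ; +-identityʳ)
  open import Data.Rational.Solver using (module +-*-Solver)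
  import Data.Rational.Unnormalised as ℚᵘ
  import Data.Rational.Unnormalised.Properties as ℚᵘ
  open import Relation.Binary.PropositionalEquality using (_≡_; refl; cong; cong₂; trans; sym; module ≡-Reasoning)
  open +-*-Solver

  ℕ→ℚᵘ : ℕ → ℚᵘ.ℚᵘ
  ℕ→ℚᵘ m = ℚᵘ.mkℚᵘ (ℤ.+ m) 0

  ℕ→ℚᵘ-homo-+ : ∀ m n → ℕ→ℚᵘ (m ℕ.+ n) ℚᵘ.≃ ℕ→ℚᵘ m ℚᵘ.+ ℕ→ℚᵘ n
  ℕ→ℚᵘ-homo-+ m n = ℚᵘ.*≡* (begin
    ℤ.+ (m ℕ.+ n) ℤ.* 1ℤ             ≡⟨ ℤ.*-identityʳ _ ⟩
    ℤ.+ m ℤ.+ ℤ.+ n                  ≡⟨ cong₂ ℤ._+_ (ℤ.*-identityʳ (ℤ.+ m)) (ℤ.*-identityʳ (ℤ.+ n)) ⟨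
    ℤ.+ m ℤ.* 1ℤ ℤ.+ ℤ.+ n ℤ.* 1ℤ     ≡⟨ ℤ.*-identityʳ _ ⟨
    (ℤ.+ m ℤ.* 1ℤ ℤ.+ ℤ.+ n ℤ.* 1ℤ) ℤ.* 1ℤ ∎)
    where open ≡-Reasoning

  ℕ→ℚ-homo-+ : ∀ m n → ℕ→ℚ (m ℕ.+ n) ≡ ℕ→ℚ m + ℕ→ℚ n
  ℕ→ℚ-homo-+ m n = toℚᵘ-injective (begin
    toℚᵘ (ℕ→ℚ (m ℕ.+ n))          ≈⟨ toℚᵘ-fromℚᵘ (ℕ→ℚᵘ (m ℕ.+ n)) ⟩
    ℕ→ℚᵘ (m ℕ.+ n)                ≈⟨ ℕ→ℚᵘ-homo-+ m n ⟩
    ℕ→ℚᵘ m ℚᵘ.+ ℕ→ℚᵘ n            ≈⟨ ℚᵘ.+-cong (toℚᵘ-fromℚᵘ (ℕ→ℚᵘ m)) (toℚᵘ-fromℚᵘ (ℕ→ℚᵘ n)) ⟨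
    toℚᵘ (ℕ→ℚ m) ℚᵘ.+ toℚᵘ (ℕ→ℚ n) ≈⟨ toℚᵘ-homo-+ (ℕ→ℚ m) (ℕ→ℚ n) ⟨
    toℚᵘ (ℕ→ℚ m + ℕ→ℚ n)          ∎)
    where open ℚᵘ.≃-Reasoning

  ℕ→ℚ-+-minus : ∀ m n → ℕ→ℚ (m ℕ.+ n) - ℕ→ℚ m ≡ ℕ→ℚ n
  ℕ→ℚ-+-minus m n = trans (cong (_- ℕ→ℚ m) (ℕ→ℚ-homo-+ m n))
                          (solve 2 (λ a b → (a :+ b) :- a := b) refl (ℕ→ℚ m) (ℕ→ℚ n))

  ∑ℚ-cong : ∀ n {g h : Fin n → ℚ} → (∀ a → g a ≡ h a) → ∑ℚ n g ≡ ∑ℚ n h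
  ∑ℚ-cong zero    g≗h = refl
  ∑ℚ-cong (suc n) g≗h = cong₂ _+_ (g≗h zero) (∑ℚ-cong n (g≗h ∘ suc))

  ∑ℚ-distrib-- : ∀ n (g h : Fin n → ℚ) → ∑ℚ n (λ a → g a - h a) ≡ ∑ℚ n g - ∑ℚ n h
  ∑ℚ-distrib-- zero    g h = refl
  ∑ℚ-distrib-- (suc n) g h = trans (cong ((g zero - h zero) +_) (∑ℚ-distrib-- n (g ∘ suc) (h ∘ suc)))
    (solve 4 (λ a b c d → (a :- b) :+ (c :- d) := (a :+ c) :- (b :+ d)) refl
      (g zero) (h zero) (∑ℚ n (g ∘ suc)) (∑ℚ n (h ∘ suc)))

  ∑ℚ-ℕ→ℚ : ∀ n (g : Fin n → ℕ) → ∑ℚ n (ℕ→ℚ ∘ g) ≡ ℕ→ℚ (∑ℕ n g)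
  ∑ℚ-ℕ→ℚ zero    g = refl
  ∑ℚ-ℕ→ℚ (suc n) g = trans (cong (ℕ→ℚ (g zero) +_) (∑ℚ-ℕ→ℚ n (g ∘ suc))) (sym (ℕ→ℚ-homo-+ (g zero) _))

  ∑ℚ-zero : ∀ n → ∑ℚ n (λ _ → 0ℚ) ≡ 0ℚ
  ∑ℚ-zero zero    = refl
  ∑ℚ-zero (suc n) = trans (+-identityˡ _) (∑ℚ-zero n)

  ∑ℚ-δ : ∀ n (i : Fin n) (c : ℚ) → ∑ℚ n (λ b → if ⌊ i Fin.≟ b ⌋ then c else 0ℚ) ≡ c
  ∑ℚ-δ (suc n) zero    c = trans (cong (c +_) (∑ℚ-zero n)) (+-identityʳ c)
  ∑ℚ-δ (suc n) (suc i) c = trans (+-identityˡ _) (trans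
    (∑ℚ-cong n (λ b → if-⇔ (mk⇔ suc-injective (cong suc)) (suc i Fin.≟ suc b) (i Fin.≟ b)))
    (∑ℚ-δ n i c))

module ValueShift where
  open import Data.Nat
  open import Data.Nat.Properties
  open import Data.Bool using (if_then_else_)
  open import Data.Product using (_×_; _,_)
  open import Relation.Nullary using (yes; no)
  open import Relation.Nullary.Decidable using (⌊_⌋)
  open import Relation.Nullary.Negation using (contradiction)
  open import Relation.Binary.PropositionalEquality using (_≡_; refl; cong; trans; subst; module ≡-Reasoning)
  open import Function.Bundles using (_⇔_; mk⇔)
  import Data.Rational as ℚ
  open Rationals using (ℕ→ℚ-homo-+; ℕ→ℚ-+-minus)

  data Position (s : ℕ) : ℕ → Set where
    below : ∀ {t} → t < s → Position s t
    above : ∀ u → Position s (s + u)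

  position : ∀ s t → Position s t
  position s t with t <? s
  ... | yes t<s = below t<s
  ... | no t≮s with m≤n⇒∃[o]m+o≡n (≮⇒≥ t≮s)
  ...   | u , refl = above u

  shift : ℕ → ℕ → ℕ → ℕ
  shift s r t = if ⌊ t <? s ⌋ then t + r else t ∸ s

  shift-below : ∀ {s} r {t} → t < s → shift s r t ≡ t + r
  shift-below {s} r {t} = if-yes (t <? s)

  shift-above : ∀ s r u → shift s r (s + u) ≡ u
  shift-above s r u = trans (if-no (s + u <? s) (≤⇒≯ (m≤m+n s u))) (m+n∸m≡n s u)

  shift-< : ∀ s r {t} → t < s + r → shift s r t < s + r
  shift-< s r {t} t<s+r with position s t
  ... | below t<s rewrite shift-below r t<s = +-monoˡ-< r t<s
  ... | above u   rewrite shift-above s r u = ≤-<-trans (m≤n+m u s) t<s+r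

  shift-inverse : ∀ s r {t} → t < s + r → shift r s (shift s r t) ≡ t
  shift-inverse s r {t} t<s+r with position s t
  ... | below t<s rewrite shift-below r t<s = trans (cong (shift r s) (+-comm t r)) (shift-above r s t)
  ... | above u   rewrite shift-above s r u =
    trans (shift-below s (+-cancelˡ-< s u r t<s+r)) (+-comm u s)

  Range : ℕ → ℕ → ℕ → Set
  Range b c v = b < v × v ≤ b + c

  shift-range-first : ∀ s r {t} → t < s + r → Range 0 s (suc t) ⇔ Range r s (suc (shift s r t))
  shift-range-first s r {t} t<s+r with position s t
  ... | below t<s rewrite shift-below r t<s =
    mk⇔ (λ _ → s≤s (m≤n+m r t) , subst (_< r + s) (+-comm r t) (+-monoʳ-< r t<s))
        (λ _ → s≤s z≤n , t<s)
  ... | above u rewrite shift-above s r u =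
    mk⇔ (λ (_ , s+u<s) → contradiction s+u<s (≤⇒≯ (m≤m+n s u)))
        (λ (r≤u , _) → contradiction (s≤s⁻¹ r≤u) (<⇒≱ (+-cancelˡ-< s u r t<s+r)))

  shift-range-rest : ∀ s r {b c t} → b + c ≤ r → t < s + r →
                     Range (s + b) c (suc t) ⇔ Range b c (suc (shift s r t))
  shift-range-rest s r {b} {c} {t} b+c≤r t<s+r with position s t
  ... | below t<s rewrite shift-below r t<s =
    mk⇔ (λ (s+b≤t , _) → contradiction (≤-trans (m≤m+n s b) (s≤s⁻¹ s+b≤t)) (<⇒≱ t<s))
        (λ (_ , t+r<b+c) → contradiction (m≤n+m r t) (<⇒≱ (≤-trans t+r<b+c b+c≤r)))
  ... | above u rewrite shift-above s r u | +-assoc s b c =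
    mk⇔ (λ (s+b≤s+u , s+u<s+b+c) → s≤s (+-cancelˡ-≤ s b u (s≤s⁻¹ s+b≤s+u)) , +-cancelˡ-< s u (b + c) s+u<s+b+c)
        (λ (b≤u , u<b+c) → s≤s (+-monoʳ-≤ s (s≤s⁻¹ b≤u)) , +-monoʳ-< s u<b+c)

  ℕ→ℚ-shift-below : ∀ {s} r {t} → t < s → ℕ→ℚ (suc (shift s r t)) ≡ ℕ→ℚ (suc t) ℚ.+ ℕ→ℚ r
  ℕ→ℚ-shift-below r {t} t<s = trans (cong (ℕ→ℚ ∘ suc) (shift-below r t<s)) (ℕ→ℚ-homo-+ (suc t) r)

  ℕ→ℚ-shift-above : ∀ s r {t} → s ≤ t → ℕ→ℚ (suc (shift s r t)) ≡ ℕ→ℚ (suc t) ℚ.- ℕ→ℚ s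
  ℕ→ℚ-shift-above s r s≤t with m≤n⇒∃[o]m+o≡n s≤t
  ... | u , refl = begin
    ℕ→ℚ (suc (shift s r (s + u)))   ≡⟨ cong (ℕ→ℚ ∘ suc) (shift-above s r u) ⟩
    ℕ→ℚ (suc u)                     ≡⟨ ℕ→ℚ-+-minus s (suc u) ⟨
    ℕ→ℚ (s + suc u) ℚ.- ℕ→ℚ s       ≡⟨ cong (λ x → ℕ→ℚ x ℚ.- ℕ→ℚ s) (+-suc s u) ⟩
    ℕ→ℚ (suc (s + u)) ℚ.- ℕ→ℚ s     ∎
    where open ≡-Reasoning

module Blocks where
  open import Data.Nat as ℕ using (ℕ; suc; _+_; _*_; _≤_; z<s; s≤s; s≤s⁻¹)
  open import Data.Nat.Properties using (≤-refl; ≤-trans; <-asym; *-identityʳ; *-zeroʳ; +-identityʳ; module ≤-Reasoning)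
  open import Data.Fin as Fin using (Fin; zero; suc; toℕ; fromℕ; inject₁; lower₁; fromℕ<; _<?_; _≟_)
  open import Data.Fin.Properties
    using (<-irrefl; toℕ-inject₁; toℕ-fromℕ; toℕ-fromℕ<; inject₁ℕ<; fromℕ≢inject₁; inject₁-injective;
           toℕ-injective; inject₁-lower₁)
  open import Data.Bool using (Bool; true; false; if_then_else_)
  open import Data.Empty using (⊥-elim)
  open import Data.Product using (_,_; ∃-syntax; Σ-syntax)
  open import Relation.Nullary using (Dec; yes; no; ¬_)
  open import Relation.Nullary.Decidable using (⌊_⌋)
  open import Relation.Binary.PropositionalEquality using (_≡_; refl; cong; cong₂; trans; sym; subst; subst₂; module ≡-Reasoning)
  open import Function.Bundles using (_⇔_; mk⇔)
  open import Function.Definitions using (Injective)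
  open NatSums
  open ValueShift

  𝟙 : Bool → ℕ
  𝟙 b = if b then 1 else 0

  𝟙-yes : ∀ {ℓ} {P : Set ℓ} (p? : Dec P) → P → 𝟙 ⌊ p? ⌋ ≡ 1
  𝟙-yes = if-yes

  𝟙-no : ∀ {ℓ} {P : Set ℓ} (p? : Dec P) → ¬ P → 𝟙 ⌊ p? ⌋ ≡ 0
  𝟙-no = if-no

  𝟙≤1 : ∀ b → 𝟙 b ≤ 1
  𝟙≤1 true  = ≤-refl
  𝟙≤1 false = ℕ.z≤n

  BlockRange : {n k : ℕ} → (Fin n → Fin k) → Fin k → ℕ → Set
  BlockRange g j = Range (before g j) (blockSize g j)

  before+blockSize≤ : ∀ {n k} (g : Fin n → Fin k) j → before g j + blockSize g j ≤ n
  before+blockSize≤ {n} g j = begin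
    before g j + blockSize g j                  ≡⟨ ∑ℕ-distrib-+ n _ _ ⟨
    ∑ℕ n (λ a → 𝟙 ⌊ g a <? j ⌋ + 𝟙 ⌊ g a ≟ j ⌋) ≤⟨ ∑ℕ-mono-≤ n (λ a → at-most-one (g a)) ⟩
    ∑ℕ n (λ _ → 1)                              ≡⟨ ∑ℕ-const n 1 ⟩
    n * 1                                       ≡⟨ *-identityʳ n ⟩
    n                                           ∎
    where
    open ≤-Reasoning
    at-most-one : ∀ x → 𝟙 ⌊ x <? j ⌋ + 𝟙 ⌊ x ≟ j ⌋ ≤ 1
    at-most-one x with x ≟ j
    ... | yes refl = subst (λ z → z + 1 ≤ 1) (sym (𝟙-no (x <? x) (<-irrefl refl))) ≤-refl
    ... | no _     = subst (_≤ 1) (sym (+-identityʳ _)) (𝟙≤1 _)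

  blockRange-value : ∀ {n k} (g : Fin n → Fin k) j {v} → BlockRange g j v → Σ[ t ∈ Fin n ] v ≡ suc (toℕ t)
  blockRange-value g j {suc t} (_ , v≤) =
    fromℕ< (≤-trans v≤ (before+blockSize≤ g j)) , cong suc (sym (toℕ-fromℕ< _))

  blockSize-relabel : ∀ {n k k′} (g : Fin n → Fin k) {ρ : Fin k → Fin k′} → Injective _≡_ _≡_ ρ →
                      ∀ j → blockSize (ρ ∘ g) (ρ j) ≡ blockSize g j
  blockSize-relabel {n} g ρ-injective j =
    ∑ℕ-cong n (λ a → if-⇔ (mk⇔ ρ-injective (cong _)) (_ ≟ _) (g a ≟ j))

  module _ {m : ℕ} where

    rotate-injective : Injective _≡_ _≡_ (rotate {m})
    rotate-injective {zero}  {zero}  _  = refl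
    rotate-injective {zero}  {suc y} eq = ⊥-elim (fromℕ≢inject₁ eq)
    rotate-injective {suc x} {zero}  eq = ⊥-elim (fromℕ≢inject₁ (sym eq))
    rotate-injective {suc x} {suc y} eq = cong suc (inject₁-injective eq)

    rotate-surjective : ∀ j′ → ∃[ j ] rotate {m} j ≡ j′
    rotate-surjective j′ with m ℕ.≟ toℕ j′
    ... | yes m≡j′ = zero , toℕ-injective (trans (toℕ-fromℕ m) m≡j′)
    ... | no m≢j′  = suc (lower₁ j′ m≢j′) , inject₁-lower₁ j′ m≢j′

  module _ {n m : ℕ} (f : Fin n → Fin (suc m)) where

    before-zero : before f zero ≡ 0
    before-zero = begin
      before f zero    ≡⟨ ∑ℕ-cong n (λ a → 𝟙-no (f a <? zero {m}) λ ()) ⟩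
      ∑ℕ n (λ _ → 0)   ≡⟨ ∑ℕ-const n 0 ⟩
      n * 0            ≡⟨ *-zeroʳ n ⟩
      0                ∎
      where open ≡-Reasoning

    blockSize+before-last : blockSize f zero + before (rotate ∘ f) (fromℕ m) ≡ n
    blockSize+before-last = begin
      blockSize f zero + before (rotate ∘ f) (fromℕ m) ≡⟨ ∑ℕ-distrib-+ n _ _ ⟨
      ∑ℕ n (λ a → 𝟙 ⌊ f a ≟ zero ⌋ + 𝟙 ⌊ rotate (f a) <? fromℕ m ⌋) ≡⟨ ∑ℕ-cong n (complement ∘ f) ⟩
      ∑ℕ n (λ _ → 1)                                   ≡⟨ ∑ℕ-const n 1 ⟩
      n * 1                                            ≡⟨ *-identityʳ n ⟩
      n                                                ∎
      where
      open ≡-Reasoning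
      complement : ∀ x → 𝟙 ⌊ x ≟ zero ⌋ + 𝟙 ⌊ rotate x <? fromℕ m ⌋ ≡ 1
      complement zero    = cong₂ _+_ (𝟙-yes (zero {m} ≟ zero) refl) (𝟙-no (fromℕ m <? fromℕ m) (<-irrefl refl))
      complement (suc x) = cong₂ _+_ (𝟙-no (suc x ≟ zero) λ ())
        (𝟙-yes (inject₁ x <? fromℕ m) (subst (toℕ (inject₁ x) ℕ.<_) (sym (toℕ-fromℕ m)) (inject₁ℕ< x)))

    before-suc : ∀ j → before f (suc j) ≡ blockSize f zero + before (rotate ∘ f) (inject₁ j)
    before-suc j = trans (∑ℕ-cong n (split ∘ f)) (∑ℕ-distrib-+ n _ _)
      where
      split : ∀ x → 𝟙 ⌊ x <? suc j ⌋ ≡ 𝟙 ⌊ x ≟ zero ⌋ + 𝟙 ⌊ rotate x <? inject₁ j ⌋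
      split zero    = trans (𝟙-yes (zero {m} <? suc j) z<s) (sym (cong₂ _+_ (𝟙-yes (zero {m} ≟ zero) refl)
        (𝟙-no (fromℕ m <? inject₁ j)
          λ lt → <-asym (inject₁ℕ< j) (subst (ℕ._< toℕ (inject₁ j)) (toℕ-fromℕ m) lt))))
      split (suc x) = if-⇔
        (mk⇔ (λ lt → subst₂ ℕ._<_ (sym (toℕ-inject₁ x)) (sym (toℕ-inject₁ j)) (s≤s⁻¹ lt))
             (λ lt → s≤s (subst₂ ℕ._<_ (toℕ-inject₁ x) (toℕ-inject₁ j) lt)))
        (suc x <? suc j) (inject₁ x <? inject₁ j)

module ShiftPermutation where
  open import Data.Nat using (_+_)
  open import Data.Nat.Properties using (+-comm)
  open import Data.Fin using (Fin; toℕ; fromℕ<)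
  open import Data.Fin.Properties using (toℕ-fromℕ<; toℕ-injective; toℕ<n)
  open import Data.Fin.Permutation using (Permutation′; permutation; _⟨$⟩ʳ_)
  open import Relation.Binary.PropositionalEquality using (_≡_; refl; cong; trans; module ≡-Reasoning)
  open ValueShift

  shiftFin : ∀ {n} s r → s + r ≡ n → Fin n → Fin n
  shiftFin s r refl x = fromℕ< (shift-< s r (toℕ<n x))

  toℕ-shiftFin : ∀ {n} s r (s+r≡n : s + r ≡ n) x → toℕ (shiftFin s r s+r≡n x) ≡ shift s r (toℕ x)
  toℕ-shiftFin s r refl x = toℕ-fromℕ< _

  shiftFin-inverse : ∀ {n} s r (s+r≡n : s + r ≡ n) (r+s≡n : r + s ≡ n) x →
                     shiftFin r s r+s≡n (shiftFin s r s+r≡n x) ≡ x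
  shiftFin-inverse s r refl r+s≡n x = toℕ-injective (begin
    toℕ (shiftFin r s r+s≡n (shiftFin s r refl x)) ≡⟨ toℕ-shiftFin r s r+s≡n _ ⟩
    shift r s (toℕ (shiftFin s r refl x))         ≡⟨ cong (shift r s) (toℕ-shiftFin s r refl x) ⟩
    shift r s (shift s r (toℕ x))                 ≡⟨ shift-inverse s r (toℕ<n x) ⟩
    toℕ x                                         ∎)
    where open ≡-Reasoning

  shiftPerm : ∀ {n} s r → s + r ≡ n → Permutation′ n
  shiftPerm s r s+r≡n = permutation (shiftFin s r s+r≡n) (shiftFin r s r+s≡n)
    (shiftFin-inverse r s r+s≡n s+r≡n) (shiftFin-inverse s r s+r≡n r+s≡n)
    where r+s≡n = trans (+-comm r s) s+r≡n

  toℕ-shiftPerm : ∀ {n} s r (s+r≡n : s + r ≡ n) x → toℕ (shiftPerm s r s+r≡n ⟨$⟩ʳ x) ≡ shift s r (toℕ x)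
  toℕ-shiftPerm = toℕ-shiftFin

module Relabelling where
  open import Data.Nat using (ℕ; suc)
  import Data.Nat.Properties as ℕ
  open import Data.Fin using (Fin; toℕ)
  open import Data.Fin.Properties using (toℕ-injective)
  open import Data.Fin.Permutation using (Permutation′; _⟨$⟩ʳ_; _⟨$⟩ˡ_; _∘ₚ_; flip; inverseˡ; inverseʳ)
  open import Data.Product using (_×_; _,_; ∃-syntax)
  open import Relation.Binary.PropositionalEquality using (_≡_; refl; cong; trans; sym; subst)
  open import Function.Bundles using (_⇔_; mk⇔; module Equivalence)
  open import Function.Definitions using (Injective)
  open Blocks using (BlockRange; blockRange-value)

  suc-toℕ-injective : ∀ {n} {x y : Fin n} → suc (toℕ x) ≡ suc (toℕ y) → x ≡ y
  suc-toℕ-injective = toℕ-injective ∘ ℕ.suc-injective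

  module _ {n k k′ : ℕ} (f : Fin n → Fin k) {ρ : Fin k → Fin k′} (ρ-injective : Injective _≡_ _≡_ ρ)
    (π : Permutation′ n)
    (range-corr : ∀ j t → BlockRange f j (suc (toℕ t)) ⇔ BlockRange (ρ ∘ f) (ρ j) (suc (toℕ (π ⟨$⟩ʳ t))))
    where

    InFace-relabel : (∀ j′ → ∃[ j ] ρ j ≡ j′) → ∀ σ → InFace f σ → InFace (ρ ∘ f) (σ ∘ₚ π)
    InFace-relabel ρ-surjective σ σ∈F j′ v with ρ-surjective j′
    ... | j , refl = mk⇔ to from
      where
      to : ∃[ a ] (ρ (f a) ≡ ρ j × permVec (σ ∘ₚ π) a ≡ v) → BlockRange (ρ ∘ f) (ρ j) v
      to (a , ρfa≡ρj , refl) =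
        Equivalence.to (range-corr j _) (Equivalence.to (σ∈F j _) (a , ρ-injective ρfa≡ρj , refl))
      from : BlockRange (ρ ∘ f) (ρ j) v → ∃[ a ] (ρ (f a) ≡ ρ j × permVec (σ ∘ₚ π) a ≡ v)
      from v∈ with blockRange-value (ρ ∘ f) (ρ j) v∈
      ... | t , refl with Equivalence.from (σ∈F j _) (Equivalence.from (range-corr j (π ⟨$⟩ˡ t))
                             (subst (BlockRange (ρ ∘ f) (ρ j) ∘ suc ∘ toℕ) (sym (inverseʳ π)) v∈))
      ...   | a , fa≡j , σa≡ =
        a , cong ρ fa≡j , cong (suc ∘ toℕ) (trans (cong (π ⟨$⟩ʳ_) (suc-toℕ-injective σa≡)) (inverseʳ π))

    InFace-unrelabel : ∀ σ → InFace (ρ ∘ f) σ → InFace f (σ ∘ₚ flip π)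
    InFace-unrelabel σ σ∈F′ j v = mk⇔ to from
      where
      to : ∃[ a ] (f a ≡ j × permVec (σ ∘ₚ flip π) a ≡ v) → BlockRange f j v
      to (a , fa≡j , refl) = Equivalence.from (range-corr j _)
        (subst (BlockRange (ρ ∘ f) (ρ j) ∘ suc ∘ toℕ) (sym (inverseʳ π))
          (Equivalence.to (σ∈F′ (ρ j) _) (a , cong ρ fa≡j , refl)))
      from : BlockRange f j v → ∃[ a ] (f a ≡ j × permVec (σ ∘ₚ flip π) a ≡ v)
      from v∈ with blockRange-value f j v∈
      ... | t , refl with Equivalence.from (σ∈F′ (ρ j) _) (Equivalence.to (range-corr j t) v∈)
      ...   | a , ρfa≡ρj , σa≡ =
        a , ρ-injective ρfa≡ρj , cong (suc ∘ toℕ) (trans (cong (π ⟨$⟩ˡ_) (suc-toℕ-injective σa≡)) (inverseˡ π))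

module Translation where
  open import Data.Nat using (ℕ; suc)
  open import Data.Fin using (toℕ)
  open import Data.Fin.Permutation using (Permutation′; _∘ₚ_; flip; inverseʳ)
  open import Data.Rational using (ℚ; 0ℚ; 1ℚ; _+_; _*_)
  open import Data.Rational.Properties using (*-identityʳ)
  open import Data.Rational.Solver using (module +-*-Solver)
  open import Data.List using (List; []; _∷_; map)
  open import Data.List.Properties using (map-∘)
  open import Data.List.Relation.Unary.All as All using (All; []; _∷_)
  open import Data.List.Relation.Unary.All.Properties using (map⁺)
  open import Data.Product using (_×_; _,_; proj₁; proj₂; map₂)
  open import Relation.Binary.PropositionalEquality using (_≡_; refl; cong; cong₂; trans; sym; module ≡-Reasoning)
  open import Function.Bundles using (mk⇔)
  open +-*-Solver

  weighted-sum-translate : ∀ {a} {A : Set a} (wt X Y : A → ℚ) (c : ℚ) (L : List A) →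
    All (λ x → Y x ≡ X x + c) L →
    sumℚ (map (λ x → wt x * Y x) L) ≡ sumℚ (map (λ x → wt x * X x) L) + c * sumℚ (map wt L)
  weighted-sum-translate wt X Y c []      []       = solve 1 (λ c → con 0ℚ := con 0ℚ :+ c :* con 0ℚ) refl c
  weighted-sum-translate wt X Y c (x ∷ L) (Yx ∷ YL) rewrite Yx | weighted-sum-translate wt X Y c L YL =
    solve 5 (λ w X c ΣX Σw → w :* (X :+ c) :+ (ΣX :+ c :* Σw) := (w :* X :+ ΣX) :+ c :* (w :+ Σw)) refl
      (wt x) (X x) c (sumℚ (map (λ x → wt x * X x) L)) (sumℚ (map wt L))

  module _ {n : ℕ} where

    vertex : Permutation′ n → Point n
    vertex σ i = ℕ→ℚ (permVec σ i)

    combination : List (ℚ × Permutation′ n) → Point n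
    combination L i = sumℚ (map (λ (lσ : ℚ × Permutation′ n) → proj₁ lσ * vertex (proj₂ lσ) i) L)

    weight : List (ℚ × Permutation′ n) → ℚ
    weight L = sumℚ (map proj₁ L)

    combination-map : ∀ (g : Permutation′ n → Permutation′ n) L i →
                      combination (map (map₂ g) L) i ≡ sumℚ (map (λ lσ → proj₁ lσ * vertex (g (proj₂ lσ)) i) L)
    combination-map g L i = cong sumℚ (sym (map-∘ L))

    weight-map : ∀ (g : Permutation′ n → Permutation′ n) L → weight (map (map₂ g) L) ≡ weight L
    weight-map g L = cong sumℚ (sym (map-∘ L))

    Conv-translate : (V V′ : Permutation′ n → Set) (v : Point n) (π : Permutation′ n) →
      (∀ σ → V σ → V′ (σ ∘ₚ π)) → (∀ σ → V′ σ → V (σ ∘ₚ flip π)) →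
      (∀ σ → V σ → ∀ i → vertex (σ ∘ₚ π) i ≡ vertex σ i + v i) →
      Conv V′ ≐ (Conv V ⊕ v)
    Conv-translate V V′ v π V⇒V′ V′⇒V vertex-π p = mk⇔ to from
      where
      to : Conv V′ p → (Conv V ⊕ v) p
      to (L , L⊆V′ , total , p≡) =
        combination Lπ⁻¹ , (Lπ⁻¹ , map⁺ (All.map (λ (wt≥0 , σ∈V′) → wt≥0 , V′⇒V _ σ∈V′) L⊆V′) ,
                            trans (weight-map _ L) total , λ _ → refl) , coordinate
        where
        Lπ⁻¹ = map (map₂ (_∘ₚ flip π)) L
        undo : ∀ i → All (λ (lσ : ℚ × Permutation′ n) →
                            vertex (proj₂ lσ) i ≡ vertex (proj₂ lσ ∘ₚ flip π) i + v i) L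
        undo i = All.map (λ (_ , σ∈V′) → trans (cong (ℕ→ℚ ∘ suc ∘ toℕ) (sym (inverseʳ π)))
                                                (vertex-π _ (V′⇒V _ σ∈V′) i)) L⊆V′
        coordinate : ∀ i → p i ≡ combination Lπ⁻¹ i + v i
        coordinate i = begin
          p i                                  ≡⟨ p≡ i ⟩
          combination L i
            ≡⟨ weighted-sum-translate proj₁ (λ lσ → vertex (proj₂ lσ ∘ₚ flip π) i) (λ lσ → vertex (proj₂ lσ) i)
                                      (v i) L (undo i) ⟩
          sumℚ (map (λ lσ → proj₁ lσ * vertex (proj₂ lσ ∘ₚ flip π) i) L) + v i * weight L
            ≡⟨ cong₂ _+_ (sym (combination-map _ L i)) (cong (v i *_) total) ⟩
          combination Lπ⁻¹ i + v i * 1ℚ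
            ≡⟨ cong (combination Lπ⁻¹ i +_) (*-identityʳ (v i)) ⟩
          combination Lπ⁻¹ i + v i
            ∎
          where open ≡-Reasoning
      from : (Conv V ⊕ v) p → Conv V′ p
      from (q , (L , L⊆V , total , q≡) , p≡) =
        Lπ , map⁺ (All.map (λ (wt≥0 , σ∈V) → wt≥0 , V⇒V′ _ σ∈V) L⊆V) , trans (weight-map _ L) total , coordinate
        where
        Lπ = map (map₂ (_∘ₚ π)) L
        coordinate : ∀ i → p i ≡ combination Lπ i
        coordinate i = begin
          p i
            ≡⟨ p≡ i ⟩
          q i + v i
            ≡⟨ cong₂ _+_ (q≡ i) (sym (*-identityʳ (v i))) ⟩
          combination L i + v i * 1ℚ
            ≡⟨ cong (λ w → combination L i + v i * w) total ⟨
          combination L i + v i * weight L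
            ≡⟨ weighted-sum-translate proj₁ (λ lσ → vertex (proj₂ lσ) i) (λ lσ → vertex (proj₂ lσ ∘ₚ π) i)
                                      (v i) L (All.map (λ (_ , σ∈V) → vertex-π _ σ∈V i) L⊆V) ⟨
          sumℚ (map (λ lσ → proj₁ lσ * vertex (proj₂ lσ ∘ₚ π) i) L)
            ≡⟨ combination-map _ L i ⟨
          combination Lπ i
            ∎
          where open ≡-Reasoning

module TranslationVector where
  open import Data.Fin as Fin using (Fin; zero; suc; _≟_)
  open import Data.Bool using (if_then_else_)
  open import Data.Rational using (ℚ; 0ℚ; 1ℚ; _-_; -_)
  open import Data.Rational.Properties using (+-identityˡ; +-identityʳ)
  open import Relation.Nullary using (yes; no; ¬_)
  open import Relation.Nullary.Decidable using (⌊_⌋)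
  open import Relation.Binary.PropositionalEquality using (_≡_; refl; cong; cong₂; trans; sym; module ≡-Reasoning)
  open Rationals
  open Blocks using (𝟙)

  wSum-formula : ∀ d {m} (f : Fin (suc d) → Fin (suc m)) i →
    wSum d f i ≡ (if ⌊ f i ≟ zero ⌋ then ℕ→ℚ (suc d) else 0ℚ) - ℕ→ℚ (blockSize f zero)
  wSum-formula d f i = begin
    wSum d f i                                ≡⟨ ∑ℚ-cong (suc d) termwise ⟩
    ∑ℚ (suc d) (λ b → δ b - ℕ→ℚ (𝟙[B₁] b))     ≡⟨ ∑ℚ-distrib-- (suc d) δ (ℕ→ℚ ∘ 𝟙[B₁]) ⟩
    ∑ℚ (suc d) δ - ∑ℚ (suc d) (ℕ→ℚ ∘ 𝟙[B₁])  ≡⟨ cong₂ _-_ (∑ℚ-δ (suc d) i c) (∑ℚ-ℕ→ℚ (suc d) 𝟙[B₁]) ⟩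
    c - ℕ→ℚ (blockSize f zero)                ∎
    where
    open ≡-Reasoning
    c : ℚ
    c = if ⌊ f i ≟ zero ⌋ then ℕ→ℚ (suc d) else 0ℚ
    δ : Fin (suc d) → ℚ
    δ b = if ⌊ i ≟ b ⌋ then c else 0ℚ
    𝟙[B₁] : Fin (suc d) → ℕ
    𝟙[B₁] b = 𝟙 ⌊ f b ≟ zero ⌋
    termwise : ∀ b → (if ⌊ f b ≟ zero ⌋ then w d b i else 0ℚ) ≡ δ b - ℕ→ℚ (𝟙[B₁] b)
    termwise b with f b ≟ zero | i ≟ b
    ... | yes fb≡0 | yes refl = cong (_- 1ℚ) (sym (if-yes (f i ≟ zero) fb≡0))
    ... | yes _    | no _     = refl
    ... | no fb≢0  | yes refl = trans (sym (+-identityʳ 0ℚ)) (cong (_- 0ℚ) (sym (if-no (f i ≟ zero) fb≢0)))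
    ... | no _     | no _     = refl

  module _ d {m} (f : Fin (suc d) → Fin (suc m)) {i : Fin (suc d)} where

    wSum-first : f i ≡ zero → wSum d f i ≡ ℕ→ℚ (suc d) - ℕ→ℚ (blockSize f zero)
    wSum-first fi≡0 = trans (wSum-formula d f i) (cong (_- ℕ→ℚ (blockSize f zero)) (if-yes (f i ≟ zero) fi≡0))

    wSum-rest : ¬ f i ≡ zero → wSum d f i ≡ - ℕ→ℚ (blockSize f zero)
    wSum-rest fi≢0 = trans (wSum-formula d f i)
      (trans (cong (_- ℕ→ℚ (blockSize f zero)) (if-no (f i ≟ zero) fi≢0)) (+-identityˡ _))

module RotatedPartition {d m : ℕ} (f : Fin (suc d) → Fin (suc m)) where
  open import Data.Nat using (_+_; _<_; s≤s⁻¹)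
  open import Data.Nat.Properties using (+-cancelˡ-≤; +-assoc; ≤-trans; m≤m+n)
  open import Data.Fin using (zero; suc; toℕ; fromℕ; inject₁)
  open import Data.Fin.Properties using (toℕ<n; 0≢1+n)
  open import Data.Fin.Permutation using (Permutation′; _⟨$⟩ʳ_; _∘ₚ_; flip)
  import Data.Rational as ℚ
  open import Data.Product using (_,_)
  open import Relation.Binary.PropositionalEquality using (_≡_; refl; cong; trans; sym; subst; subst₂; module ≡-Reasoning)
  open import Function.Bundles using (_⇔_; module Equivalence)
  open Rationals using (ℕ→ℚ-+-minus)
  open ValueShift
  open ShiftPermutation
  open Blocks
  open Relabelling
  open Translation using (vertex)
  open TranslationVector

  s r : ℕ
  s = blockSize f zero
  r = before (rotate ∘ f) (fromℕ m)

  s+r≡n : s + r ≡ suc d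
  s+r≡n = blockSize+before-last f

  π : Permutation′ (suc d)
  π = shiftPerm s r s+r≡n

  rotate-range : ∀ j t → BlockRange f j (suc (toℕ t)) ⇔ BlockRange (rotate ∘ f) (rotate j) (suc (toℕ (π ⟨$⟩ʳ t)))
  rotate-range j t rewrite toℕ-shiftPerm s r s+r≡n t = ranges j (subst (toℕ t <_) (sym s+r≡n) (toℕ<n t))
    where
    ranges : ∀ j {u} → u < s + r → BlockRange f j (suc u) ⇔ BlockRange (rotate ∘ f) (rotate j) (suc (shift s r u))
    ranges zero {u} u<s+r =
      subst₂ (λ b c → Range b s (suc u) ⇔ Range r c (suc (shift s r u)))
        (sym (before-zero f)) (sym (blockSize-relabel f rotate-injective zero)) (shift-range-first s r u<s+r)
    ranges (suc j) {u} u<s+r =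
      subst₂ (λ b c′ → Range b c (suc u) ⇔ Range b′ c′ (suc (shift s r u)))
        (sym (before-suc f j)) (sym (blockSize-relabel f rotate-injective (suc j)))
        (shift-range-rest s r b′+c≤r u<s+r)
      where
      b′ = before (rotate ∘ f) (inject₁ j)
      c = blockSize f (suc j)
      b′+c≤r : b′ + c ≤ r
      b′+c≤r = +-cancelˡ-≤ s (b′ + c) r
        (subst₂ _≤_ (trans (cong (_+ c) (before-suc f j)) (+-assoc s b′ c)) (sym s+r≡n)
                    (before+blockSize≤ f (suc j)))

  rotate-InFace : ∀ σ → InFace f σ → InFace (rotate ∘ f) (σ ∘ₚ π)
  rotate-InFace = InFace-relabel f rotate-injective π rotate-range rotate-surjective

  unrotate-InFace : ∀ σ → InFace (rotate ∘ f) σ → InFace f (σ ∘ₚ flip π)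
  unrotate-InFace = InFace-unrelabel f rotate-injective π rotate-range

  vertex-shift : ∀ σ → InFace f σ → ∀ i → vertex (σ ∘ₚ π) i ≡ vertex σ i ℚ.+ wSum d f i
  vertex-shift σ σ∈F i = trans (cong (ℕ→ℚ ∘ suc) (toℕ-shiftPerm s r s+r≡n (σ ⟨$⟩ʳ i)))
    (by-block (f i) refl (Equivalence.to (σ∈F (f i) _) (i , refl , refl)))
    where
    t = toℕ (σ ⟨$⟩ʳ i)
    by-block : ∀ j → f i ≡ j → BlockRange f j (suc t) → ℕ→ℚ (suc (shift s r t)) ≡ ℕ→ℚ (suc t) ℚ.+ wSum d f i
    by-block zero fi≡0 (_ , t<) = begin
      ℕ→ℚ (suc (shift s r t))                     ≡⟨ ℕ→ℚ-shift-below r t<s ⟩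
      ℕ→ℚ (suc t) ℚ.+ ℕ→ℚ r                      ≡⟨ cong (ℕ→ℚ (suc t) ℚ.+_) (ℕ→ℚ-+-minus s r) ⟨
      ℕ→ℚ (suc t) ℚ.+ (ℕ→ℚ (s + r) ℚ.- ℕ→ℚ s)    ≡⟨ cong (λ x → ℕ→ℚ (suc t) ℚ.+ (ℕ→ℚ x ℚ.- ℕ→ℚ s)) s+r≡n ⟩
      ℕ→ℚ (suc t) ℚ.+ (ℕ→ℚ (suc d) ℚ.- ℕ→ℚ s)    ≡⟨ cong (ℕ→ℚ (suc t) ℚ.+_) (wSum-first d f fi≡0) ⟨
      ℕ→ℚ (suc t) ℚ.+ wSum d f i                  ∎
      where
      open ≡-Reasoning
      t<s : t < s
      t<s = subst (λ b → suc t ≤ b + s) (before-zero f) t<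
    by-block (suc j) fi≡1+j (s+b<1+t , _) = trans
      (ℕ→ℚ-shift-above s r (≤-trans (m≤m+n s _) (s≤s⁻¹ (subst (_< suc t) (before-suc f j) s+b<1+t))))
      (cong (ℕ→ℚ (suc t) ℚ.+_) (sym (wSum-rest d f λ fi≡0 → 0≢1+n (trans (sym fi≡0) fi≡1+j))))

lemma5p2 : (d : ℕ) → 2 ≤ d → (m : ℕ) (f : Fin (suc d) → Fin (suc m)) →
    IsOrderedPartition f →
    Face (rotate ∘ f) ≐ (Face f ⊕ wSum d f)
lemma5p2 d _ m f _ =
  Conv-translate (InFace f) (InFace (rotate ∘ f)) (wSum d f) π rotate-InFace unrotate-InFace vertex-shift
  where
  open Translation using (Conv-translate)
  open RotatedPartition f
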